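{- Let $n,m$ be strictly positive natural numbers and $\sigma$ a fixed-point free permutation of $\{1,\dots,m\}$. Let $a^j_i$ ($1 \le i \le m$, $1 \le j \le n$) be pairwise distinct variables, and let $i_1,\dots,i_n \in \{1,\dots,m\}$ (not necessarily distinct). Consider the sets $A_1 = \{a^1_{i_1}, a^2_{i_1}, \dots, a^n_{i_1}\}$ and, for $2 \le k \le n$, $A_k = \{a^j_{i_k} \mid j \neq k\} \cup \{a^k_{\sigma(i_k)}\}$. Then $A_1 \cap A_2 \cap \dots \cap A_n$ has at most one element. -}

module Defs where

open import Data.Nat using (ℕ)
open import Data.Fin using (Fin; zero; suc)
open import Data.Fin.Permutation using (Permutation′; _⟨$⟩ʳ_)
open import Data.Product using (∃-syntax; _×_)
open import Data.Sum using (_⊎_)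
open import Relation.Binary.PropositionalEquality using (_≡_; _≢_)

-- Indices are 0-based: i ∈ Fin m stands for 1..m, k ∈ Fin n for 1..n.
-- a i j  is the variable a^j_i ;  ix k  is i_k.
-- InA a σ ix k x  :  x ∈ A_k   (k = zero is A_1).
InA : {X : Set} {m n : ℕ} → (Fin m → Fin n → X) → Permutation′ m → (Fin n → Fin m)
      → Fin n → X → Set
InA a σ ix zero x = ∃[ j ] (x ≡ a (ix zero) j)
InA a σ ix (suc k) x =
  (∃[ j ] (j ≢ suc k × x ≡ a (ix (suc k)) j)) ⊎ (x ≡ a (σ ⟨$⟩ʳ ix (suc k)) (suc k))

module Submission where

open import Defs
open import Data.Nat using (ℕ; suc; _<_)
open import Data.Fin using (Fin; zero; suc)
open import Data.Fin.Permutation using (Permutation′; _⟨$⟩ʳ_)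
open import Data.Product using (_×_; _,_; proj₁; proj₂)
open import Data.Sum using (inj₁; inj₂)
open import Data.Empty using (⊥-elim)
open import Relation.Binary.PropositionalEquality using (_≡_; _≢_; sym; trans; cong)

-- Every element of A₁ is a^j_{i₁} for some j. If j = 1 for both x and y they
-- coincide. Otherwise, say x = a^k_{i₁} with k ≥ 2; the only variable of A_k in
-- column k is a^k_{σ(i_k)}, so x is that variable and i₁ = σ(i_k). Then y ∈ A₁ lies
-- in row i₁ = σ(i_k) ≠ i_k, so within A_k it too can only be a^k_{σ(i_k)}.

module _ {m n : ℕ} {X : Set} (σ : Permutation′ m) {a : Fin m → Fin (suc n) → X}
         (a-injective : ∀ i i′ j j′ → a i j ≡ a i′ j′ → i ≡ i′ × j ≡ j′)
         (ix : Fin (suc n) → Fin m) where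

  InA-suc-column : ∀ {i k x} → x ≡ a i (suc k) → InA a σ ix (suc k) x
                 → x ≡ a (σ ⟨$⟩ʳ ix (suc k)) (suc k)
  InA-suc-column x≡ (inj₁ (j , j≢ , x≡′)) =
    ⊥-elim (j≢ (sym (proj₂ (a-injective _ _ _ _ (trans (sym x≡) x≡′)))))
  InA-suc-column x≡ (inj₂ x≡′) = x≡′

  InA-suc-shifted-row : (∀ i → σ ⟨$⟩ʳ i ≢ i)
                      → ∀ {j k y} → y ≡ a (σ ⟨$⟩ʳ ix (suc k)) j → InA a σ ix (suc k) y
                      → y ≡ a (σ ⟨$⟩ʳ ix (suc k)) (suc k)
  InA-suc-shifted-row σ-fixedPointFree y≡ (inj₁ (_ , _ , y≡′)) =
    ⊥-elim (σ-fixedPointFree _ (proj₁ (a-injective _ _ _ _ (trans (sym y≡) y≡′))))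
  InA-suc-shifted-row _ _ (inj₂ y≡′) = y≡′

  ⋂A-unique-off-first-column : (∀ i → σ ⟨$⟩ʳ i ≢ i)
    → ∀ {k j x y} → x ≡ a (ix zero) (suc k) → y ≡ a (ix zero) j
    → InA a σ ix (suc k) x → InA a σ ix (suc k) y → x ≡ y
  ⋂A-unique-off-first-column σ-fixedPointFree {k} {j} {x} {y} x≡ y≡ x∈A y∈A =
    trans x≡shifted (sym (InA-suc-shifted-row σ-fixedPointFree y≡shifted y∈A))
    where
    x≡shifted : x ≡ a (σ ⟨$⟩ʳ ix (suc k)) (suc k)
    x≡shifted = InA-suc-column x≡ x∈A

    i₁≡σi : ix zero ≡ σ ⟨$⟩ʳ ix (suc k)
    i₁≡σi = proj₁ (a-injective _ _ _ _ (trans (sym x≡) x≡shifted))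

    y≡shifted : y ≡ a (σ ⟨$⟩ʳ ix (suc k)) j
    y≡shifted = trans y≡ (cong (λ i → a i j) i₁≡σi)

lemma3p12 : (n m : ℕ) → 0 < n → 0 < m
    → (σ : Permutation′ m) → (∀ i → σ ⟨$⟩ʳ i ≢ i)
    → (X : Set) (a : Fin m → Fin n → X)
    → (∀ i i′ j j′ → a i j ≡ a i′ j′ → i ≡ i′ × j ≡ j′)
    → (ix : Fin n → Fin m)
    → (x y : X) → (∀ k → InA a σ ix k x) → (∀ k → InA a σ ix k y) → x ≡ y
lemma3p12 (suc n) _ _ _ σ σ-fixedPointFree _ a a-injective ix x y x∈A y∈A
  with x∈A zero | y∈A zero
... | zero , x≡ | zero , y≡ = trans x≡ (sym y≡)
... | suc k , x≡ | _ , y≡ =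
  ⋂A-unique-off-first-column σ a-injective ix σ-fixedPointFree x≡ y≡ (x∈A (suc k)) (y∈A (suc k))
... | zero , x≡ | suc k , y≡ =
  sym (⋂A-unique-off-first-column σ a-injective ix σ-fixedPointFree y≡ x≡ (y∈A (suc k)) (x∈A (suc k)))
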